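{- Let $\epsilon'>0$. If $\hat{\mathbb G}$ is $\epsilon'$-far from being $H$-free, then with probability at least $1-(1-\epsilon'/\alpha)^{\xi_1}$ the set $V(G_0)$ contains a vertex of some subgraph of $\hat{\mathbb G}$ isomorphic to $H$.
   Context: Setting: $p,r\in\mathbb N$, $p>1$; $H$ is a connected graph with at least two vertices, at most $r$ vertices and $r$-admissibility at most $p$; $G$ is a graph with $V(G)=[n]$ and $\mathbb G=(G,\le)$ an ordering of $V(G)$ with $r$-admissibility at most $p$ (for a total order, a path from $v$ to $x$ is admissible if $x<v$ and all internal vertices exceed $v$; the $r$-admissibility of the ordered graph is the maximum over $v$ of the largest number of admissible paths of length $\le r$ from $v$ that are pairwise vertex-disjoint apart from $v$). $\alpha,\beta,\delta\in\mathbb N$ and $\hat{\mathbb G}$ is the subgraph of $G$ (with the same vertex set and order) produced by the trimming procedure of the paper with parameters $\alpha,\beta,\delta$; the only property of it needed here is its first step, which guarantees that $\hat{\mathbb G}$ is obtained from $G$ by deleting edges and that for every $v$ with $\deg_G(v)>\alpha$, all edges $vu$ of $G$ with $u<v$ are deleted, so that every edge $uv$ of $\hat{\mathbb G}$ with $u>v$ has $\deg_G(u)\le\alpha$ [the remaining steps delete further edges according to admissible-path and Strata counts]. $G_0$ is the edgeless graph whose vertex set consists of $\xi_1$ vertices of $V(G)$ chosen independently and uniformly at random (the initial sample of the testing algorithm). $\hat{\mathbb G}$ is $\epsilon'$-far from being $H$-free if at least $\epsilon' n$ edges must be removed from it to obtain a graph with no subgraph isomorphic to $H$.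
   Formalization: The parameter $\epsilon'$ is a positive rational number. -}

module Defs where

open import Data.Bool using (Bool; true; false; if_then_else_)
open import Data.Nat as ℕ using (ℕ; zero; suc; NonZero)
open import Data.Nat.Properties using (m^n≢0)
open import Data.Integer using (+_)
open import Data.Fin as Fin using (Fin)
open import Data.Fin.Permutation using (Permutation′; _⟨$⟩ʳ_)
open import Data.Vec using (Vec; []; _∷_)
open import Data.List using (List; []; _∷_; _++_; length; map; concatMap; allFin)
open import Data.List.Relation.Unary.All using (All)
open import Data.List.Relation.Unary.AllPairs using (AllPairs)
open import Data.List.Relation.Unary.Unique.Propositional using (Unique)
open import Data.List.Relation.Binary.Disjoint.Propositional using (Disjoint)
open import Data.Product using (Σ; ∃; _×_; _,_; proj₁; proj₂)
open import Data.Sum using (_⊎_)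
open import Data.Unit using (⊤)
open import Function.Definitions using (Injective)
open import Relation.Nullary using (¬_; Dec; does)
open import Relation.Unary using (Pred; Decidable)
import Level
open import Relation.Binary.PropositionalEquality using (_≡_)
open import Data.Rational as ℚ using (ℚ; 1ℚ; _/_)

record Graph (n : ℕ) : Set where
  field
    adj   : Fin n → Fin n → Bool
    adj-sym : ∀ u v → adj u v ≡ adj v u
    adj-irr : ∀ v → adj v v ≡ false
open Graph public

Edge : ∀ {n} → Graph n → Fin n → Fin n → Set
Edge G u v = adj G u v ≡ true

countB : ∀ {A : Set} → (A → Bool) → List A → ℕ
countB f []       = 0
countB f (x ∷ xs) = if f x then suc (countB f xs) else countB f xs

degree : ∀ {n} → Graph n → Fin n → ℕ
degree {n} G v = countB (adj G v) (allFin n)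

numEdges : ∀ {n} → Graph n → ℕ
numEdges {n} G =
  countB (λ uv → if ℕ._<ᵇ_ (Fin.toℕ (proj₁ uv)) (Fin.toℕ (proj₂ uv)) then adj G (proj₁ uv) (proj₂ uv) else false)
         (concatMap (λ u → map (λ v → u , v) (allFin n)) (allFin n))

_⊆ᴱ_ : ∀ {n} → Graph n → Graph n → Set
G' ⊆ᴱ G = ∀ u v → Edge G' u v → Edge G u v

-- Subgraphs isomorphic to H: injective edge-preserving maps V(H) → V(G).

record Copy {k n : ℕ} (H : Graph k) (G : Graph n) : Set where
  field
    emb     : Fin k → Fin n
    emb-inj : Injective _≡_ _≡_ emb
    emb-hom : ∀ i j → Edge H i j → Edge G (emb i) (emb j)
open Copy public

HFree : ∀ {k n} → Graph k → Graph n → Set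
HFree H G = ¬ Copy H G

Far : ∀ {k n} → ℚ → Graph k → Graph n → Set
Far {n = n} ε H G =
  ∀ (G' : Graph n) → G' ⊆ᴱ G → HFree H G' →
    ε ℚ.* (+ n / 1) ℚ.≤ (+ (numEdges G ℕ.∸ numEdges G') / 1)

Walk : ∀ {n} → Graph n → List (Fin n) → Set
Walk G []           = ⊤
Walk G (x ∷ [])     = ⊤
Walk G (x ∷ y ∷ zs) = Edge G x y × Walk G (y ∷ zs)

Connected : ∀ {k} → Graph k → Set
Connected {k} H = ∀ (a b : Fin k) → a ≡ b ⊎ ∃ λ mid → Walk H (a ∷ mid ++ b ∷ [])

-- Orderings and r-admissibility.
-- An ordering of V(G) = Fin n is given by a rank permutation:
-- u ≤ v in the ordering iff rank(u) ≤ rank(v).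

_<[_]_ : ∀ {n} → Fin n → Permutation′ n → Fin n → Set
u <[ σ ] v = σ ⟨$⟩ʳ u Fin.< σ ⟨$⟩ʳ v

-- A path from v is described by its list of internal vertices `mid`
-- and its end vertex x; the path is v ∷ mid ++ [x], of length |mid|+1.
-- It is admissible (and of length ≤ r) if it is a path of G (a walk with
-- distinct vertices), x < v, all internal vertices exceed v.
AdmissiblePath : ∀ {n} → Graph n → Permutation′ n → ℕ → Fin n →
                 List (Fin n) × Fin n → Set
AdmissiblePath G σ r v (mid , x) =
  Walk G (v ∷ mid ++ x ∷ []) ×
  Unique (v ∷ mid ++ x ∷ []) ×
  x <[ σ ] v ×
  All (λ w → v <[ σ ] w) mid ×
  suc (length mid) ℕ.≤ r

pathRest : ∀ {n} → List (Fin n) × Fin n → List (Fin n)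
pathRest (mid , x) = mid ++ x ∷ []

AdmAtMost : ∀ {n} → Graph n → Permutation′ n → ℕ → ℕ → Set
AdmAtMost {n} G σ r p =
  ∀ (v : Fin n) (F : List (List (Fin n) × Fin n)) →
    All (AdmissiblePath G σ r v) F →
    AllPairs (λ P Q → Disjoint (pathRest P) (pathRest Q)) F →
    length F ℕ.≤ p

GraphAdmAtMost : ∀ {k} → Graph k → ℕ → ℕ → Set
GraphAdmAtMost H r p = ∃ λ σ → AdmAtMost H σ r p

-- Uniform sampling of ξ vertices of [n] independently: the sample space is
-- Vec (Fin n) ξ with the uniform distribution (n^ξ equally likely outcomes).

allVecs : (ξ n : ℕ) → List (Vec (Fin n) ξ)
allVecs zero    n = [] ∷ []
allVecs (suc ξ) n = concatMap (λ a → map (a ∷_) (allVecs ξ n)) (allFin n)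

Pr : ∀ {ξ n} .{{_ : NonZero n}} {P : Pred (Vec (Fin n) ξ) Level.0ℓ} → Decidable P → ℚ
Pr {ξ} {n} d = + countB (λ s → does (d s)) (allVecs ξ n) / (n ℕ.^ ξ)
  where instance _ = m^n≢0 n ξ

_^ℚ_ : ℚ → ℕ → ℚ
q ^ℚ zero  = 1ℚ
q ^ℚ suc m = q ℚ.* (q ^ℚ m)

-- The sample s (the vertex set V(G₀)) contains a vertex of some subgraph of
-- G isomorphic to H.
HitsCopy : ∀ {k n ξ} → Graph k → Graph n → Pred (Vec (Fin n) ξ) Level.0ℓ
HitsCopy H G s = ∃ λ (c : Copy H G) → ∃ λ i → ∃ λ j → Data.Vec.lookup s i ≡ emb c j
  where import Data.Vec

{-# OPTIONS --safe #-}
-- Let S be the set of vertices lying in some copy of H in Ĝ. Deleting every edge of Ĝ with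
-- both ends in S leaves an H-free graph (H has an edge), so by farness at least ε'n edges are
-- deleted. Charge each deleted edge to its endpoint u that comes later in σ: u lies in S and
-- has a lower neighbour in Ĝ, so the first trimming step gives deg_G(u) ≤ α, and hence
-- ε'n ≤ |S|α. Each of the ξ independent uniform vertices misses S with probability
-- 1 - |S|/n ≤ 1 - ε'/α.
module Submission where

module Counting where

  open import Data.Bool using (Bool; true; false; not; _∧_; if_then_else_)
  open import Data.Empty using (⊥; ⊥-elim)
  open import Data.List using (List; []; _∷_; _++_; map; concatMap; length)
  open import Data.List.Properties using (length-++; length-map)
  open import Data.Nat using (ℕ; suc; _+_; _*_; _≤_; z≤n; s≤s)
  import Data.Nat.Properties as ℕ
  open import Algebra.Properties.CommutativeSemigroup ℕ.+-commutativeSemigroup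
    using (interchange; x∙yz≈y∙xz)
  open import Data.Product using (_×_; _,_; ∃; uncurry)
  open import Data.Sum using (_⊎_; inj₁; inj₂)
  open import Function using (flip; case_of_)
  open import Relation.Binary.PropositionalEquality
  open import Defs using (countB)

  private variable A B C : Set

  pairs : List A → List B → List (A × B)
  pairs xs ys = concatMap (λ a → map (a ,_) ys) xs

  indicator : Bool → ℕ
  indicator b = if b then 1 else 0

  countB-∷ : (f : A → Bool) (x : A) (xs : List A) → countB f (x ∷ xs) ≡ indicator (f x) + countB f xs
  countB-∷ f x xs with f x
  ... | true  = refl
  ... | false = refl

  countB-++ : (f : A → Bool) (xs ys : List A) → countB f (xs ++ ys) ≡ countB f xs + countB f ys
  countB-++ f []       ys = refl
  countB-++ f (x ∷ xs) ys with f x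
  ... | true  = cong suc (countB-++ f xs ys)
  ... | false = countB-++ f xs ys

  countB-map : (f : B → Bool) (g : A → B) (xs : List A) →
               countB f (map g xs) ≡ countB (λ x → f (g x)) xs
  countB-map f g []       = refl
  countB-map f g (x ∷ xs) with f (g x)
  ... | true  = cong suc (countB-map f g xs)
  ... | false = countB-map f g xs

  countB-cong : {f g : A → Bool} → (∀ x → f x ≡ g x) → (xs : List A) → countB f xs ≡ countB g xs
  countB-cong f≗g []       = refl
  countB-cong {f = f} {g} f≗g (x ∷ xs) = begin
    countB f (x ∷ xs)                ≡⟨ countB-∷ f x xs ⟩
    indicator (f x) + countB f xs    ≡⟨ cong₂ _+_ (cong indicator (f≗g x)) (countB-cong f≗g xs) ⟩
    indicator (g x) + countB g xs    ≡⟨ sym (countB-∷ g x xs) ⟩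
    countB g (x ∷ xs)                ∎
    where open ≡-Reasoning

  countB-mono : {f g : A → Bool} → (∀ x → f x ≡ true → g x ≡ true) →
                (xs : List A) → countB f xs ≤ countB g xs
  countB-mono f⇒g []       = z≤n
  countB-mono {f = f} {g} f⇒g (x ∷ xs) with f x in fx | g x in gx
  ... | true  | true  = s≤s (countB-mono f⇒g xs)
  ... | true  | false = case trans (sym (f⇒g x fx)) gx of λ ()
  ... | false | true  = ℕ.m≤n⇒m≤1+n (countB-mono f⇒g xs)
  ... | false | false = countB-mono f⇒g xs

  countB-none : {f : A → Bool} → (∀ x → f x ≡ true → ⊥) → (xs : List A) → countB f xs ≡ 0
  countB-none none []       = refl
  countB-none {f = f} none (x ∷ xs) with f x in fx
  ... | true  = ⊥-elim (none x fx)
  ... | false = countB-none none xs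

  countB≡0⊎witness : (f : A → Bool) (xs : List A) → countB f xs ≡ 0 ⊎ ∃ λ x → f x ≡ true
  countB≡0⊎witness f []       = inj₁ refl
  countB≡0⊎witness f (x ∷ xs) with f x in fx
  ... | true  = inj₂ (x , fx)
  ... | false = countB≡0⊎witness f xs

  countB-true : (xs : List A) → countB (λ _ → true) xs ≡ length xs
  countB-true []       = refl
  countB-true (_ ∷ xs) = cong suc (countB-true xs)

  countB-split : (f g : A → Bool) (xs : List A) →
                 countB f xs ≡ countB (λ x → f x ∧ not (g x)) xs + countB (λ x → f x ∧ g x) xs
  countB-split f g []       = refl
  countB-split f g (x ∷ xs) with f x | g x
  ... | true  | true  = trans (cong suc (countB-split f g xs)) (sym (ℕ.+-suc _ _))
  ... | true  | false = cong suc (countB-split f g xs)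
  ... | false | _     = countB-split f g xs

  countB-complement : (P : A → Bool) (xs : List A) →
                      countB (λ x → not (P x)) xs + countB P xs ≡ length xs
  countB-complement P xs = trans (sym (countB-split (λ _ → true) P xs)) (countB-true xs)

  countB-+-mono : {f g h k : A → Bool} →
                  (∀ x → indicator (f x) + indicator (g x) ≤ indicator (h x) + indicator (k x)) →
                  (xs : List A) → countB f xs + countB g xs ≤ countB h xs + countB k xs
  countB-+-mono pointwise []       = z≤n
  countB-+-mono {f = f} {g} {h} {k} pointwise (x ∷ xs) = begin
    countB f (x ∷ xs) + countB g (x ∷ xs)
      ≡⟨ cong₂ _+_ (countB-∷ f x xs) (countB-∷ g x xs) ⟩
    (indicator (f x) + countB f xs) + (indicator (g x) + countB g xs)
      ≡⟨ interchange (indicator (f x)) (countB f xs) (indicator (g x)) (countB g xs) ⟩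
    (indicator (f x) + indicator (g x)) + (countB f xs + countB g xs)
      ≤⟨ ℕ.+-mono-≤ (pointwise x) (countB-+-mono pointwise xs) ⟩
    (indicator (h x) + indicator (k x)) + (countB h xs + countB k xs)
      ≡⟨ interchange (indicator (h x)) (indicator (k x)) (countB h xs) (countB k xs) ⟩
    (indicator (h x) + countB h xs) + (indicator (k x) + countB k xs)
      ≡⟨ sym (cong₂ _+_ (countB-∷ h x xs) (countB-∷ k x xs)) ⟩
    countB h (x ∷ xs) + countB k (x ∷ xs) ∎
    where open ℕ.≤-Reasoning

  countB-concatMap-∷ : (f : B → Bool) (g : A → B) (F : A → List B) (xs : List A) →
    countB f (concatMap (λ a → g a ∷ F a) xs) ≡ countB (λ a → f (g a)) xs + countB f (concatMap F xs)
  countB-concatMap-∷ f g F []       = refl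
  countB-concatMap-∷ f g F (x ∷ xs) = begin
    countB f (g x ∷ F x ++ concatMap (λ a → g a ∷ F a) xs)
      ≡⟨ countB-∷ f (g x) (F x ++ concatMap (λ a → g a ∷ F a) xs) ⟩
    indicator (f (g x)) + countB f (F x ++ concatMap (λ a → g a ∷ F a) xs)
      ≡⟨ cong (indicator (f (g x)) +_) (countB-++ f (F x) (concatMap (λ a → g a ∷ F a) xs)) ⟩
    indicator (f (g x)) + (countB f (F x) + countB f (concatMap (λ a → g a ∷ F a) xs))
      ≡⟨ cong (λ c → indicator (f (g x)) + (countB f (F x) + c)) (countB-concatMap-∷ f g F xs) ⟩
    indicator (f (g x)) + (countB f (F x) + (countB (λ a → f (g a)) xs + countB f (concatMap F xs)))
      ≡⟨ cong (indicator (f (g x)) +_) (x∙yz≈y∙xz (countB f (F x)) (countB (λ a → f (g a)) xs) _) ⟩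
    indicator (f (g x)) + (countB (λ a → f (g a)) xs + (countB f (F x) + countB f (concatMap F xs)))
      ≡⟨ sym (ℕ.+-assoc (indicator (f (g x))) (countB (λ a → f (g a)) xs) _) ⟩
    (indicator (f (g x)) + countB (λ a → f (g a)) xs) + (countB f (F x) + countB f (concatMap F xs))
      ≡⟨ cong₂ _+_ (sym (countB-∷ (λ a → f (g a)) x xs)) (sym (countB-++ f (F x) (concatMap F xs))) ⟩
    countB (λ a → f (g a)) (x ∷ xs) + countB f (F x ++ concatMap F xs) ∎
    where open ≡-Reasoning

  countB-pairs-[]ʳ : (f : A × B → Bool) (xs : List A) → countB f (pairs xs []) ≡ 0
  countB-pairs-[]ʳ f []       = refl
  countB-pairs-[]ʳ f (_ ∷ xs) = countB-pairs-[]ʳ f xs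

  countB-pairs-flip : (R : A → B → Bool) (xs : List A) (ys : List B) →
                      countB (uncurry R) (pairs xs ys) ≡ countB (uncurry (flip R)) (pairs ys xs)
  countB-pairs-flip R []       ys = sym (countB-pairs-[]ʳ (uncurry (flip R)) ys)
  countB-pairs-flip R (x ∷ xs) ys = begin
    countB (uncurry R) (map (x ,_) ys ++ pairs xs ys)
      ≡⟨ countB-++ (uncurry R) (map (x ,_) ys) _ ⟩
    countB (uncurry R) (map (x ,_) ys) + countB (uncurry R) (pairs xs ys)
      ≡⟨ cong₂ _+_ (countB-map (uncurry R) (x ,_) ys) (countB-pairs-flip R xs ys) ⟩
    countB (R x) ys + countB (uncurry (flip R)) (pairs ys xs)
      ≡⟨ sym (countB-concatMap-∷ (uncurry (flip R)) (_, x) (λ y → map (y ,_) xs) ys) ⟩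
    countB (uncurry (flip R)) (pairs ys (x ∷ xs)) ∎
    where open ≡-Reasoning

  private
    indicator-orient : {r r′ d d′ : Bool} → (r ≡ true → r′ ≡ true → ⊥) →
                       (r ≡ true → d ≡ true ⊎ d′ ≡ true) → (r′ ≡ true → d′ ≡ true ⊎ d ≡ true) →
                       indicator r + indicator r′ ≤ indicator d + indicator d′
    indicator-orient {false} {false} asym cover cover′ = z≤n
    indicator-orient {true}  {true}  asym cover cover′ = ⊥-elim (asym refl refl)
    indicator-orient {true}  {false} asym cover cover′ = one (cover refl)
      where
      one : ∀ {d d′} → d ≡ true ⊎ d′ ≡ true → 1 ≤ indicator d + indicator d′
      one (inj₁ refl) = s≤s z≤n
      one {d} (inj₂ refl) = ℕ.m≤n+m 1 (indicator d)
    indicator-orient {false} {true} {d} {d′} asym cover cover′ =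
      ℕ.≤-trans (indicator-orient {true} {false} {d′} {d} (λ _ ()) cover′ (λ ()))
                (ℕ.≤-reflexive (ℕ.+-comm (indicator d′) (indicator d)))

  -- Each pair {a, b} carrying R in one of its two orientations is charged to an
  -- orientation carrying D; counting both orientations of every pair doubles both sides.
  countB-orient-≤ : (R D : A → A → Bool) (xs : List A) →
                    (∀ a b → R a b ≡ true → R b a ≡ true → ⊥) →
                    (∀ a b → R a b ≡ true → D a b ≡ true ⊎ D b a ≡ true) →
                    countB (uncurry R) (pairs xs xs) ≤ countB (uncurry D) (pairs xs xs)
  countB-orient-≤ R D xs asym cover = ℕ.≮⇒≥ (λ d<r → ℕ.<⇒≱ (ℕ.+-mono-< d<r d<r) doubled)
    where
    open ℕ.≤-Reasoning
    doubled : countB (uncurry R) (pairs xs xs) + countB (uncurry R) (pairs xs xs)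
            ≤ countB (uncurry D) (pairs xs xs) + countB (uncurry D) (pairs xs xs)
    doubled = begin
      countB (uncurry R) (pairs xs xs) + countB (uncurry R) (pairs xs xs)
        ≡⟨ cong (countB (uncurry R) (pairs xs xs) +_) (countB-pairs-flip R xs xs) ⟩
      countB (uncurry R) (pairs xs xs) + countB (uncurry (flip R)) (pairs xs xs)
        ≤⟨ countB-+-mono (λ (a , b) → indicator-orient (asym a b) (cover a b) (cover b a)) (pairs xs xs) ⟩
      countB (uncurry D) (pairs xs xs) + countB (uncurry (flip D)) (pairs xs xs)
        ≡⟨ cong (countB (uncurry D) (pairs xs xs) +_) (sym (countB-pairs-flip D xs xs)) ⟩
      countB (uncurry D) (pairs xs xs) + countB (uncurry D) (pairs xs xs) ∎

  countB-rows-≤ : {f : C → Bool} {g : A → B → C} {P : A → Bool} {ys : List B} {c : ℕ} →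
                  (∀ a b → f (g a b) ≡ true → P a ≡ true) → (∀ a → countB (λ b → f (g a b)) ys ≤ c) →
                  (xs : List A) → countB f (concatMap (λ a → map (g a) ys) xs) ≤ countB P xs * c
  countB-rows-≤ f⇒P row [] = z≤n
  countB-rows-≤ {C = C} {f = f} {g} {P} {ys} {c} f⇒P row (x ∷ xs) = begin
    countB f (map (g x) ys ++ rest)                ≡⟨ countB-++ f (map (g x) ys) rest ⟩
    countB f (map (g x) ys) + countB f rest        ≡⟨ cong (_+ countB f rest) (countB-map f (g x) ys) ⟩
    countB (λ b → f (g x b)) ys + countB f rest    ≤⟨ ℕ.+-monoʳ-≤ _ (countB-rows-≤ f⇒P row xs) ⟩
    countB (λ b → f (g x b)) ys + countB P xs * c  ≤⟨ firstRow ⟩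
    countB P (x ∷ xs) * c                          ∎
    where
    open ℕ.≤-Reasoning
    rest : List C
    rest = concatMap (λ a → map (g a) ys) xs
    firstRow : countB (λ b → f (g x b)) ys + countB P xs * c ≤ countB P (x ∷ xs) * c
    firstRow with P x in Px
    ... | true  = ℕ.+-monoˡ-≤ (countB P xs * c) (row x)
    ... | false = ℕ.≤-reflexive (cong (_+ countB P xs * c)
                    (countB-none (λ b fgxb → case trans (sym (f⇒P x b fgxb)) Px of λ ()) ys))

  length-concatMap-map : (g : A → B → C) (ys : List B) (xs : List A) →
                         length (concatMap (λ a → map (g a) ys) xs) ≡ length xs * length ys
  length-concatMap-map g ys []       = refl
  length-concatMap-map g ys (x ∷ xs) =
    trans (length-++ (map (g x) ys)) (cong₂ _+_ (length-map (g x) ys) (length-concatMap-map g ys xs))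

module Sampling where

  open import Data.Bool using (Bool; true; false; not; _∧_)
  open import Data.Bool.Properties using (∧-conicalˡ; ∧-conicalʳ)
  open import Data.Fin using (Fin; zero; suc)
  open import Data.List using (List; length; allFin)
  open import Data.List.Properties using (length-tabulate)
  open import Data.Nat using (ℕ; zero; suc; _+_; _*_; _^_; _≤_)
  import Data.Nat.Properties as ℕ
  open import Data.Vec using (Vec; []; _∷_; lookup)
  open import Function using (id; case_of_)
  open import Relation.Binary.PropositionalEquality
  open import Defs using (countB; allVecs)
  open Counting

  private variable A : Set

  allᵇ : ∀ {m} → (A → Bool) → Vec A m → Bool
  allᵇ P []       = true
  allᵇ P (x ∷ xs) = P x ∧ allᵇ P xs

  allᵇ-lookup : ∀ {m} (P : A → Bool) (xs : Vec A m) →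
                (∀ i → P (lookup xs i) ≡ true) → allᵇ P xs ≡ true
  allᵇ-lookup P []       all = refl
  allᵇ-lookup P (x ∷ xs) all =
    trans (cong (_∧ allᵇ P xs) (all zero)) (allᵇ-lookup P xs (λ i → all (suc i)))

  length-allVecs : ∀ ξ n → length (allVecs ξ n) ≡ n ^ ξ
  length-allVecs zero    n = refl
  length-allVecs (suc ξ) n =
    trans (length-concatMap-map _∷_ (allVecs ξ n) (allFin n))
          (cong₂ _*_ (length-tabulate {n = n} id) (length-allVecs ξ n))

  countB-allᵇ-allVecs : ∀ {n} (P : Fin n → Bool) ξ →
                        countB (allᵇ P) (allVecs ξ n) ≤ countB P (allFin n) ^ ξ
  countB-allᵇ-allVecs P zero    = ℕ.≤-refl
  countB-allᵇ-allVecs {n} P (suc ξ) = countB-rows-≤ (λ a s → ∧-conicalˡ (P a) (allᵇ P s)) row (allFin n)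
    where
    row : ∀ a → countB (λ s → P a ∧ allᵇ P s) (allVecs ξ n) ≤ countB P (allFin n) ^ ξ
    row a = ℕ.≤-trans (countB-mono (λ s → ∧-conicalʳ (P a) (allᵇ P s)) (allVecs ξ n)) (countB-allᵇ-allVecs P ξ)

  -- The misses are among the (n - |S|)^ξ samples avoiding S.
  countB-hits-≥ : ∀ {n ξ} (hit : Vec (Fin n) ξ → Bool) (S : Fin n → Bool) →
                  (∀ s i → S (lookup s i) ≡ true → hit s ≡ true) →
                  n ^ ξ ≤ countB hit (allVecs ξ n) + countB (λ v → not (S v)) (allFin n) ^ ξ
  countB-hits-≥ {n} {ξ} hit S S⇒hit = begin
    n ^ ξ                                     ≡⟨ sym (length-allVecs ξ n) ⟩
    length samples                            ≡⟨ sym (countB-complement hit samples) ⟩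
    countB (λ s → not (hit s)) samples + countB hit samples
      ≤⟨ ℕ.+-monoˡ-≤ _ (countB-mono miss⇒avoid samples) ⟩
    countB (allᵇ (λ v → not (S v))) samples + countB hit samples
      ≤⟨ ℕ.+-monoˡ-≤ _ (countB-allᵇ-allVecs (λ v → not (S v)) ξ) ⟩
    countB (λ v → not (S v)) (allFin n) ^ ξ + countB hit samples
      ≡⟨ ℕ.+-comm _ (countB hit samples) ⟩
    countB hit samples + countB (λ v → not (S v)) (allFin n) ^ ξ ∎
    where
    open ℕ.≤-Reasoning
    samples : List (Vec (Fin n) ξ)
    samples = allVecs ξ n
    miss⇒avoid : ∀ s → not (hit s) ≡ true → allᵇ (λ v → not (S v)) s ≡ true
    miss⇒avoid s miss = allᵇ-lookup _ s avoid
      where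
      avoid : ∀ i → not (S (lookup s i)) ≡ true
      avoid i with S (lookup s i) in inS
      ... | true  = case trans (sym (cong not (S⇒hit s i inS))) miss of λ ()
      ... | false = refl

module EdgeDeletion where

  open import Data.Bool using (Bool; true; false; not; _∧_; if_then_else_)
  open import Data.Bool.Properties using (∧-comm; ∧-conicalˡ; ∧-conicalʳ; T-≡)
  open import Data.Empty using (⊥)
  open import Data.Fin as Fin using (Fin; zero; suc; toℕ)
  import Data.Fin.Properties as Fin
  open import Data.Fin.Permutation using (Permutation′; _⟨$⟩ʳ_)
  open import Data.List using (List; []; _∷_; allFin)
  open import Data.Nat as ℕ using (ℕ; suc; _+_; _*_; _≤_; _<_; _<ᵇ_; s≤s)
  import Data.Nat.Properties as ℕ
  open import Data.Product using (∃₂; _×_; _,_; proj₁; proj₂; uncurry)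
  open import Data.Sum using (_⊎_; inj₁; inj₂)
  open import Function using (case_of_)
  open import Function.Bundles using (Injection; Equivalence)
  open import Function.Properties.Inverse using (Inverse⇒Injection)
  open import Relation.Binary.Definitions using (tri<; tri≈; tri>)
  open import Relation.Binary.PropositionalEquality
  open import Defs
  open Counting

  private variable n k : ℕ

  ⟨$⟩ʳ-injective : (σ : Permutation′ n) {u v : Fin n} → σ ⟨$⟩ʳ u ≡ σ ⟨$⟩ʳ v → u ≡ v
  ⟨$⟩ʳ-injective σ = Injection.injective (Inverse⇒Injection σ)

  _<ᵇ[_]_ : Fin n → Permutation′ n → Fin n → Bool
  u <ᵇ[ σ ] v = toℕ (σ ⟨$⟩ʳ u) <ᵇ toℕ (σ ⟨$⟩ʳ v)

  lowerDegree : Graph n → Permutation′ n → Fin n → ℕ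
  lowerDegree {n} G σ u = countB (λ v → adj G u v ∧ v <ᵇ[ σ ] u) (allFin n)

  <ᵇ[]⇒<[] : {σ : Permutation′ n} {u v : Fin n} → u <ᵇ[ σ ] v ≡ true → u <[ σ ] v
  <ᵇ[]⇒<[] {σ = σ} {u} {v} e =
    ℕ.<ᵇ⇒< (toℕ (σ ⟨$⟩ʳ u)) (toℕ (σ ⟨$⟩ʳ v)) (Equivalence.from T-≡ e)

  lowerDegree-≤ : (G′ G : Graph n) (σ : Permutation′ n) {α : ℕ} → G′ ⊆ᴱ G →
                  (∀ u v → Edge G′ u v → v <[ σ ] u → degree G u ≤ α) → ∀ u → lowerDegree G′ σ u ≤ α
  lowerDegree-≤ {n} G′ G σ G′⊆G degree≤α u
    with countB≡0⊎witness (λ v → adj G′ u v ∧ v <ᵇ[ σ ] u) (allFin n)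
  ... | inj₁ none     = ℕ.≤-trans (ℕ.≤-reflexive none) ℕ.z≤n
  ... | inj₂ (v , uv) =
    ℕ.≤-trans (countB-mono (λ w uw → G′⊆G u w (∧-conicalˡ _ _ uw)) (allFin n))
              (degree≤α u v (∧-conicalˡ _ _ uv) (<ᵇ[]⇒<[] {σ = σ} (∧-conicalʳ (adj G′ u v) _ uv)))

  deleteInside : Graph n → (Fin n → Bool) → Graph n
  deleteInside G S = record
    { adj     = λ u v → adj G u v ∧ not (S u ∧ S v)
    ; adj-sym = λ u v → cong₂ (λ a b → a ∧ not b) (adj-sym G u v) (∧-comm (S u) (S v))
    ; adj-irr = λ v → cong (λ a → a ∧ not (S v ∧ S v)) (adj-irr G v)
    }

  deleteInside-⊆ᴱ : (G : Graph n) (S : Fin n → Bool) → deleteInside G S ⊆ᴱ G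
  deleteInside-⊆ᴱ G S u v = ∧-conicalˡ (adj G u v) _

  Copy-mono : {H : Graph k} {G′ G : Graph n} → G′ ⊆ᴱ G → Copy H G′ → Copy H G
  Copy-mono G′⊆G c = record
    { emb = emb c ; emb-inj = emb-inj c ; emb-hom = λ i j e → G′⊆G _ _ (emb-hom c i j e) }

  Connected⇒Edge : (H : Graph k) → Connected H → 2 ≤ k → ∃₂ λ a b → Edge H a b
  Connected⇒Edge {suc (suc k)} H conn _ with conn zero (suc zero)
  ... | inj₂ ([]      , e , _) = zero , suc zero , e
  ... | inj₂ (y ∷ mid , e , _) = zero , y , e
  Connected⇒Edge {suc ℕ.zero} H conn (s≤s ())

  deleteInside-HFree : (H : Graph k) (G : Graph n) (S : Fin n → Bool) → (∃₂ λ a b → Edge H a b) →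
                       (∀ (c : Copy H G) j → S (emb c j) ≡ true) → HFree H (deleteInside G S)
  deleteInside-HFree H G S (a , b , ab) inS c = case trans (sym kept) (cong not both) of λ ()
    where
    c′ : Copy H G
    c′ = Copy-mono (deleteInside-⊆ᴱ G S) c
    kept : not (S (emb c a) ∧ S (emb c b)) ≡ true
    kept = ∧-conicalʳ (adj G (emb c a) (emb c b)) _ (emb-hom c a b ab)
    both : S (emb c a) ∧ S (emb c b) ≡ true
    both = cong₂ _∧_ (inS c′ a) (inS c′ b)

  -- numEdges G is, by definition, countB (edgeᵇ G) (pairs (allFin n) (allFin n)).
  edgeᵇ : Graph n → Fin n × Fin n → Bool
  edgeᵇ G (u , v) = if toℕ u <ᵇ toℕ v then adj G u v else false

  edgeᵇ-true : (G : Graph n) {u v : Fin n} → edgeᵇ G (u , v) ≡ true → toℕ u < toℕ v × Edge G u v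
  edgeᵇ-true G {u} {v} e with toℕ u <ᵇ toℕ v in u<v | e
  ... | true  | uv = ℕ.<ᵇ⇒< (toℕ u) (toℕ v) (Equivalence.from T-≡ u<v) , uv

  edgeᵇ-deleteInside : (G : Graph n) (S : Fin n → Bool) (u v : Fin n) →
                       edgeᵇ (deleteInside G S) (u , v) ≡ edgeᵇ G (u , v) ∧ not (S u ∧ S v)
  edgeᵇ-deleteInside G S u v with toℕ u <ᵇ toℕ v
  ... | true  = refl
  ... | false = refl

  numEdges-deleteInside : (G : Graph n) (σ : Permutation′ n) (S : Fin n → Bool) {α : ℕ} →
                          (∀ u → lowerDegree G σ u ≤ α) →
                          numEdges G ≤ numEdges (deleteInside G S) + countB S (allFin n) * α
  numEdges-deleteInside {n} G σ S {α} lowerDegree≤α = begin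
    numEdges G
      ≡⟨ countB-split (edgeᵇ G) (λ (u , v) → S u ∧ S v) vertexPairs ⟩
    countB (λ (u , v) → edgeᵇ G (u , v) ∧ not (S u ∧ S v)) vertexPairs
      + countB (uncurry inside) vertexPairs
      ≡⟨ cong (_+ countB (uncurry inside) vertexPairs)
              (sym (countB-cong (λ (u , v) → edgeᵇ-deleteInside G S u v) vertexPairs)) ⟩
    numEdges (deleteInside G S) + countB (uncurry inside) vertexPairs
      ≤⟨ ℕ.+-monoʳ-≤ _ (countB-orient-≤ inside down (allFin n) inside-asym inside-oriented) ⟩
    numEdges (deleteInside G S) + countB (uncurry down) vertexPairs
      ≤⟨ ℕ.+-monoʳ-≤ _ (countB-rows-≤ (λ a b → ∧-conicalˡ (S a) _) downDegree≤α (allFin n)) ⟩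
    numEdges (deleteInside G S) + countB S (allFin n) * α ∎
    where
    open ℕ.≤-Reasoning
    vertexPairs : List (Fin n × Fin n)
    vertexPairs = pairs (allFin n) (allFin n)

    inside down : Fin n → Fin n → Bool
    inside u v = edgeᵇ G (u , v) ∧ (S u ∧ S v)
    down   u v = S u ∧ (adj G u v ∧ v <ᵇ[ σ ] u)

    inside-asym : ∀ u v → inside u v ≡ true → inside v u ≡ true → ⊥
    inside-asym u v uv vu = ℕ.<-asym (proj₁ (edgeᵇ-true G (∧-conicalˡ (edgeᵇ G (u , v)) _ uv)))
                                     (proj₁ (edgeᵇ-true G (∧-conicalˡ (edgeᵇ G (v , u)) _ vu)))

    orient : ∀ u v → Edge G u v → S u ≡ true → S v ≡ true → down u v ≡ true ⊎ down v u ≡ true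
    orient u v uv Su Sv with Fin.<-cmp (σ ⟨$⟩ʳ u) (σ ⟨$⟩ʳ v)
    ... | tri< σu<σv _ _ =
      inj₂ (cong₂ _∧_ Sv (cong₂ _∧_ (trans (adj-sym G v u) uv) (Equivalence.to T-≡ (ℕ.<⇒<ᵇ σu<σv))))
    ... | tri> _ _ σv<σu =
      inj₁ (cong₂ _∧_ Su (cong₂ _∧_ uv (Equivalence.to T-≡ (ℕ.<⇒<ᵇ σv<σu))))
    ... | tri≈ _ σu≡σv _ with ⟨$⟩ʳ-injective σ σu≡σv
    ...   | refl = case trans (sym uv) (adj-irr G u) of λ ()

    inside-oriented : ∀ u v → inside u v ≡ true → down u v ≡ true ⊎ down v u ≡ true
    inside-oriented u v uv =
      orient u v (proj₂ (edgeᵇ-true G edge)) (∧-conicalˡ (S u) _ ends) (∧-conicalʳ (S u) _ ends)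
      where
      edge : edgeᵇ G (u , v) ≡ true
      edge = ∧-conicalˡ (edgeᵇ G (u , v)) _ uv
      ends : S u ∧ S v ≡ true
      ends = ∧-conicalʳ (edgeᵇ G (u , v)) _ uv

    downDegree≤α : ∀ u → countB (down u) (allFin n) ≤ α
    downDegree≤α u = ℕ.≤-trans (countB-mono (λ v → ∧-conicalʳ (S u) _) (allFin n)) (lowerDegree≤α u)

module CopyMembership where

  open import Data.Bool using (Bool; true)
  open import Data.Fin using (Fin; zero)
  open import Data.Nat using (ℕ; suc)
  open import Data.Product using (_,_)
  open import Data.Vec using (Vec; replicate; lookup)
  open import Data.Vec.Properties using (lookup-replicate)
  open import Relation.Binary.PropositionalEquality
  open import Relation.Nullary using (does; yes; no)
  open import Relation.Nullary.Decidable using (dec-true)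
  open import Relation.Unary using (Decidable)
  open import Defs

  private variable k n ξ : ℕ

  -- Whether v lies in a copy of H is decided by running d on the constant sample (v, …, v).
  inCopy : {H : Graph k} {G : Graph n} → Decidable (HitsCopy {ξ = suc ξ} H G) → Fin n → Bool
  inCopy {ξ = ξ} d v = does (d (replicate (suc ξ) v))

  inCopy-emb : {H : Graph k} {G : Graph n} (d : Decidable (HitsCopy {ξ = suc ξ} H G)) →
               (c : Copy H G) (j : Fin k) → inCopy d (emb c j) ≡ true
  inCopy-emb d c j = dec-true (d _) (c , zero , j , refl)

  inCopy⇒hit : {H : Graph k} {G : Graph n} (d : Decidable (HitsCopy {ξ = suc ξ} H G)) →
               (s : Vec (Fin n) (suc ξ)) (i : Fin (suc ξ)) →
               inCopy d (lookup s i) ≡ true → does (d s) ≡ true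
  inCopy⇒hit {ξ = ξ} d s i e with d (replicate (suc ξ) (lookup s i)) | e
  ... | yes (c , i′ , j , eq) | _ =
    dec-true (d s) (c , i , j , trans (sym (lookup-replicate i′ (lookup s i))) eq)
  ... | no _                  | ()

module RationalBounds where

  open import Data.Integer as ℤ using (+_)
  import Data.Integer.Properties as ℤ
  open import Data.Nat as ℕ using (ℕ; zero; suc)
  import Data.Nat.Properties as ℕ
  open import Data.Rational
  open import Data.Rational.Literals using (fromℤ)
  open import Data.Rational.Properties
  open import Data.Rational.Solver using (module +-*-Solver)
  import Data.Rational.Unnormalised as ℚᵘ
  import Data.Rational.Unnormalised.Properties as ℚᵘ
  open import Relation.Binary.PropositionalEquality
  open import Defs using (_^ℚ_)
  open +-*-Solver

  fromℕ : ℕ → ℚ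
  fromℕ a = + a / 1

  fromℕ≡fromℤ : ∀ a → fromℕ a ≡ fromℤ (+ a)
  fromℕ≡fromℤ a = ↥p/↧p≡p (fromℤ (+ a))

  -- fromℤ (+ a) + fromℤ (+ b) unfolds to (+ a ℤ.* + 1 ℤ.+ + b ℤ.* + 1) / 1.
  fromℕ-+ : ∀ a b → fromℕ (a ℕ.+ b) ≡ fromℕ a + fromℕ b
  fromℕ-+ a b = begin
    + (a ℕ.+ b) / 1
      ≡⟨ cong (_/ 1) (ℤ.pos-+ a b) ⟩
    (+ a ℤ.+ + b) / 1
      ≡⟨ sym (cong₂ (λ x y → (x ℤ.+ y) / 1) (ℤ.*-identityʳ (+ a)) (ℤ.*-identityʳ (+ b))) ⟩
    fromℤ (+ a) + fromℤ (+ b)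
      ≡⟨ sym (cong₂ _+_ (fromℕ≡fromℤ a) (fromℕ≡fromℤ b)) ⟩
    fromℕ a + fromℕ b ∎
    where open ≡-Reasoning

  fromℕ-* : ∀ a b → fromℕ (a ℕ.* b) ≡ fromℕ a * fromℕ b
  fromℕ-* a b = begin
    + (a ℕ.* b) / 1             ≡⟨ cong (_/ 1) (ℤ.pos-* a b) ⟩
    fromℤ (+ a) * fromℤ (+ b)   ≡⟨ sym (cong₂ _*_ (fromℕ≡fromℤ a) (fromℕ≡fromℤ b)) ⟩
    fromℕ a * fromℕ b           ∎
    where open ≡-Reasoning

  fromℕ-^ : ∀ a k → fromℕ (a ℕ.^ k) ≡ fromℕ a ^ℚ k
  fromℕ-^ a zero    = refl
  fromℕ-^ a (suc k) = trans (fromℕ-* a (a ℕ.^ k)) (cong (fromℕ a *_) (fromℕ-^ a k))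

  fromℕ-mono-≤ : ∀ {a b} → a ℕ.≤ b → fromℕ a ≤ fromℕ b
  fromℕ-mono-≤ {a} {b} a≤b = subst₂ _≤_ (sym (fromℕ≡fromℤ a)) (sym (fromℕ≡fromℤ b))
    (*≤* (subst₂ ℤ._≤_ (sym (ℤ.*-identityʳ (+ a))) (sym (ℤ.*-identityʳ (+ b))) (ℤ.+≤+ a≤b)))

  0≤fromℕ : ∀ a → 0ℚ ≤ fromℕ a
  0≤fromℕ a = fromℕ-mono-≤ {0} {a} ℕ.z≤n

  fromℕ-pos : ∀ a .{{_ : ℕ.NonZero a}} → Positive (fromℕ a)
  fromℕ-pos a = normalize-pos a 1

  /-*-fromℕ : ∀ a b .{{_ : ℕ.NonZero b}} → (+ a / b) * fromℕ b ≡ fromℕ a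
  /-*-fromℕ a (suc k) = toℚᵘ-injective (begin
    toℚᵘ ((+ a / suc k) * fromℕ (suc k))
      ≈⟨ toℚᵘ-homo-* (+ a / suc k) (fromℕ (suc k)) ⟩
    toℚᵘ (+ a / suc k) ℚᵘ.* toℚᵘ (fromℕ (suc k))
      ≈⟨ ℚᵘ.*-cong (toℚᵘ-fromℚᵘ (ℚᵘ.mkℚᵘ (+ a) k)) (toℚᵘ-fromℚᵘ (ℚᵘ.mkℚᵘ (+ suc k) 0)) ⟩
    ℚᵘ.mkℚᵘ (+ a) k ℚᵘ.* ℚᵘ.mkℚᵘ (+ suc k) 0
      ≈⟨ ℚᵘ.*≡* cancel ⟩
    ℚᵘ.mkℚᵘ (+ a) 0
      ≈⟨ ℚᵘ.≃-sym (toℚᵘ-fromℚᵘ (ℚᵘ.mkℚᵘ (+ a) 0)) ⟩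
    toℚᵘ (fromℕ a) ∎)
    where
    open ℚᵘ.≃-Reasoning
    cancel : (+ a ℤ.* + suc k) ℤ.* + 1 ≡ + a ℤ.* + suc (k ℕ.* 1)
    cancel rewrite ℕ.*-identityʳ k = ℤ.*-identityʳ (+ a ℤ.* + suc k)

  ^ℚ-nonNeg : ∀ {p} → 0ℚ ≤ p → ∀ k → 0ℚ ≤ p ^ℚ k
  ^ℚ-nonNeg 0≤p zero    = 0≤fromℕ 1
  ^ℚ-nonNeg {p} 0≤p (suc k) = nonNegative⁻¹ (p * p ^ℚ k)
    {{nonNeg*nonNeg⇒nonNeg p {{nonNegative 0≤p}} (p ^ℚ k) {{nonNegative (^ℚ-nonNeg 0≤p k)}}}}

  ^ℚ-mono-≤ : ∀ {p q} → 0ℚ ≤ p → p ≤ q → ∀ k → p ^ℚ k ≤ q ^ℚ k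
  ^ℚ-mono-≤ 0≤p p≤q zero    = ≤-refl
  ^ℚ-mono-≤ {p} {q} 0≤p p≤q (suc k) =
    ≤-trans (*-monoʳ-≤-nonNeg (p ^ℚ k) {{nonNegative (^ℚ-nonNeg 0≤p k)}} p≤q)
            (*-monoˡ-≤-nonNeg q {{nonNegative (≤-trans 0≤p p≤q)}} (^ℚ-mono-≤ 0≤p p≤q k))

  ^ℚ-distrib-* : ∀ p q k → (p * q) ^ℚ k ≡ p ^ℚ k * q ^ℚ k
  ^ℚ-distrib-* p q zero    = refl
  ^ℚ-distrib-* p q (suc k) = begin
    (p * q) * (p * q) ^ℚ k
      ≡⟨ cong ((p * q) *_) (^ℚ-distrib-* p q k) ⟩
    (p * q) * (p ^ℚ k * q ^ℚ k)
      ≡⟨ solve 4 (λ p q x y → (p :* q) :* (x :* y) := (p :* x) :* (q :* y)) refl p q (p ^ℚ k) (q ^ℚ k) ⟩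
    (p * p ^ℚ k) * (q * q ^ℚ k) ∎
    where open ≡-Reasoning

  -- A single uniform vertex misses a set of s = n - m vertices with probability m/n.
  missProbability-≤ : ∀ {n α s m} .{{_ : ℕ.NonZero n}} .{{_ : ℕ.NonZero α}} (ε : ℚ) →
                      ε * fromℕ n ≤ fromℕ (s ℕ.* α) → m ℕ.+ s ≡ n → + m / n ≤ 1ℚ - ε * (+ 1 / α)
  missProbability-≤ {n} {α} {s} {m} ε εn≤sα m+s≡n = begin
    r             ≡⟨ solve 2 (λ r x → r := (r :+ x) :- x) refl r x ⟩
    (r + x) - x   ≤⟨ +-monoˡ-≤ (- x) r+x≤1 ⟩
    1ℚ - x        ∎
    where
    open ≤-Reasoning
    r x N A : ℚ
    r = + m / n
    x = ε * (+ 1 / α)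
    N = fromℕ n
    A = fromℕ α
    NA-pos : Positive (N * A)
    NA-pos = subst Positive (fromℕ-* n α) (fromℕ-pos (n ℕ.* α) {{ℕ.m*n≢0 n α}})
    r+x≤1 : r + x ≤ 1ℚ
    r+x≤1 = *-cancelʳ-≤-pos (N * A) {{NA-pos}} (begin
      (r + x) * (N * A)
        ≡⟨ solve 5 (λ r e i n a → (r :+ e :* i) :* (n :* a) := (r :* n) :* a :+ (e :* n) :* (i :* a))
                   refl r ε (+ 1 / α) N A ⟩
      (r * N) * A + (ε * N) * ((+ 1 / α) * A)
        ≡⟨ cong₂ (λ y z → y * A + (ε * N) * z) (/-*-fromℕ m n) (/-*-fromℕ 1 α) ⟩
      fromℕ m * A + (ε * N) * 1ℚ
        ≡⟨ cong (λ y → fromℕ m * A + y) (*-identityʳ (ε * N)) ⟩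
      fromℕ m * A + ε * N
        ≤⟨ +-monoʳ-≤ (fromℕ m * A) εn≤sα ⟩
      fromℕ m * A + fromℕ (s ℕ.* α)
        ≡⟨ cong (λ y → fromℕ m * A + y) (fromℕ-* s α) ⟩
      fromℕ m * A + fromℕ s * A
        ≡⟨ solve 3 (λ m s a → m :* a :+ s :* a := con 1ℚ :* ((m :+ s) :* a)) refl (fromℕ m) (fromℕ s) A ⟩
      1ℚ * ((fromℕ m + fromℕ s) * A)
        ≡⟨ cong (λ y → 1ℚ * (y * A)) (trans (sym (fromℕ-+ m s)) (cong fromℕ m+s≡n)) ⟩
      1ℚ * (N * A) ∎)

  hitProbability-≥ : ∀ {n c m ξ} .{{_ : ℕ.NonZero n}} → n ℕ.^ ξ ℕ.≤ c ℕ.+ m ℕ.^ ξ →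
                     1ℚ - (+ m / n) ^ℚ ξ ≤ (+ c / (n ℕ.^ ξ)) {{ℕ.m^n≢0 n ξ}}
  hitProbability-≥ {n} {c} {m} {ξ} nξ≤c+mξ = *-cancelʳ-≤-pos P {{fromℕ-pos (n ℕ.^ ξ)}} (begin
    (1ℚ - r ^ℚ ξ) * P
      ≡⟨ solve 2 (λ y p → (con 1ℚ :- y) :* p := p :- y :* p) refl (r ^ℚ ξ) P ⟩
    P - r ^ℚ ξ * P
      ≡⟨ cong (λ y → P - y) rξP≡Mξ ⟩
    P - Mξ
      ≤⟨ +-monoˡ-≤ (- Mξ) (fromℕ-mono-≤ nξ≤c+mξ) ⟩
    fromℕ (c ℕ.+ m ℕ.^ ξ) - Mξ
      ≡⟨ cong (_- Mξ) (fromℕ-+ c (m ℕ.^ ξ)) ⟩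
    (fromℕ c + Mξ) - Mξ
      ≡⟨ solve 2 (λ c y → (c :+ y) :- y := c) refl (fromℕ c) Mξ ⟩
    fromℕ c
      ≡⟨ sym (/-*-fromℕ c (n ℕ.^ ξ)) ⟩
    (+ c / (n ℕ.^ ξ)) * P ∎)
    where
    open ≤-Reasoning
    instance _ = ℕ.m^n≢0 n ξ
    r P Mξ : ℚ
    r  = + m / n
    P  = fromℕ (n ℕ.^ ξ)
    Mξ = fromℕ (m ℕ.^ ξ)
    rξP≡Mξ : r ^ℚ ξ * P ≡ Mξ
    rξP≡Mξ = begin-equality
      r ^ℚ ξ * P              ≡⟨ cong (r ^ℚ ξ *_) (fromℕ-^ n ξ) ⟩
      r ^ℚ ξ * fromℕ n ^ℚ ξ   ≡⟨ sym (^ℚ-distrib-* r (fromℕ n) ξ) ⟩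
      (r * fromℕ n) ^ℚ ξ      ≡⟨ cong (_^ℚ ξ) (/-*-fromℕ m n) ⟩
      fromℕ m ^ℚ ξ            ≡⟨ sym (fromℕ-^ m ξ) ⟩
      Mξ                      ∎

  sampling-bound : ∀ {n α s m c ξ} .{{_ : ℕ.NonZero n}} .{{_ : ℕ.NonZero α}} (ε : ℚ) →
                   ε * fromℕ n ≤ fromℕ (s ℕ.* α) → m ℕ.+ s ≡ n → n ℕ.^ ξ ℕ.≤ c ℕ.+ m ℕ.^ ξ →
                   1ℚ - (1ℚ - ε * (+ 1 / α)) ^ℚ ξ ≤ (+ c / (n ℕ.^ ξ)) {{ℕ.m^n≢0 n ξ}}
  sampling-bound {n} {α} {s} {m} {c} {ξ} ε εn≤sα m+s≡n nξ≤c+mξ = begin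
    1ℚ - (1ℚ - ε * (+ 1 / α)) ^ℚ ξ
      ≤⟨ +-monoʳ-≤ 1ℚ (neg-antimono-≤ (^ℚ-mono-≤ 0≤m/n (missProbability-≤ {m = m} ε εn≤sα m+s≡n) ξ)) ⟩
    1ℚ - (+ m / n) ^ℚ ξ
      ≤⟨ hitProbability-≥ {n} {c} {m} {ξ} nξ≤c+mξ ⟩
    (+ c / (n ℕ.^ ξ)) {{ℕ.m^n≢0 n ξ}} ∎
    where
    open ≤-Reasoning
    0≤m/n : 0ℚ ≤ + m / n
    0≤m/n = nonNegative⁻¹ (+ m / n) {{normalize-nonNeg m n}}

open import Defs
open import Data.Nat using (ℕ; NonZero; _<_; _≤_)
open import Data.Integer using (+_)
open import Data.Fin.Permutation using (Permutation′)
open import Data.Rational using (ℚ; 0ℚ; 1ℚ; _/_; _*_; _-_) renaming (_<_ to _<ℚ_; _≤_ to _≤ℚ_)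
open import Relation.Unary using (Decidable)
import Data.Nat as ℕ
open import Data.Nat.Properties using (m≤n+o⇒m∸n≤o)
open import Data.List using (allFin)
open import Data.List.Properties using (length-tabulate)
open import Data.Rational.Properties using (≤-trans; ≤-reflexive; +-inverseʳ)
open import Function using (id)
open import Relation.Binary.PropositionalEquality using (_≡_; trans)
open import Relation.Nullary using (does)
open import Data.Bool using (Bool; not)
open import Data.Fin using (Fin)
open import Data.Vec using (Vec)
open Counting using (countB-complement)
open Sampling using (countB-hits-≥)
open EdgeDeletion
open CopyMembership
open RationalBounds using (fromℕ; fromℕ-mono-≤; 0≤fromℕ; sampling-bound)

-- Only the first trimming step (the degree bound on Ĝ) enters the argument.
lemma8 : (p r : ℕ) → 1 < p →
    (k : ℕ) (H : Graph k) → Connected H → 2 ≤ k → k ≤ r → GraphAdmAtMost H r p →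
    (n : ℕ) .{{_ : NonZero n}} (G : Graph n) (σ : Permutation′ n) → AdmAtMost G σ r p →
    (α : ℕ) .{{_ : NonZero α}} (Ĝ : Graph n) → Ĝ ⊆ᴱ G →
    (∀ u v → Edge Ĝ u v → v <[ σ ] u → degree G u ≤ α) →
    (ξ₁ : ℕ) (ε' : ℚ) → 0ℚ <ℚ ε' → Far ε' H Ĝ →
    (d : Decidable (HitsCopy {ξ = ξ₁} H Ĝ)) →
    (1ℚ - ((1ℚ - ε' * (+ 1 / α)) ^ℚ ξ₁)) ≤ℚ Pr d
lemma8 _ _ _ _ _ _ _ _ _ n _ _ _ _ _ _ _ ℕ.zero _ _ _ d =
  ≤-trans (≤-reflexive (+-inverseʳ 1ℚ)) (0≤fromℕ (countB (λ s → does (d s)) (allVecs 0 n)))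
lemma8 _ _ _ k H connected 2≤k _ _ n G σ _ α Ĝ Ĝ⊆G degree≤α (ℕ.suc ξ) ε' _ far d =
  sampling-bound {s = |S|} {m = n-|S|} {c = hits} {ξ = ℕ.suc ξ}
    ε' εn≤|S|α n-|S|+|S|≡n (countB-hits-≥ hit inside (inCopy⇒hit d))
  where
  inside : Fin n → Bool
  inside = inCopy d
  hit : Vec (Fin n) (ℕ.suc ξ) → Bool
  hit s = does (d s)
  |S| n-|S| hits : ℕ
  |S|   = countB inside (allFin n)
  n-|S| = countB (λ v → not (inside v)) (allFin n)
  hits  = countB hit (allVecs (ℕ.suc ξ) n)
  Ĝ′ : Graph n
  Ĝ′ = deleteInside Ĝ inside

  removed≤|S|α : numEdges Ĝ ℕ.∸ numEdges Ĝ′ ≤ |S| ℕ.* α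
  removed≤|S|α =
    m≤n+o⇒m∸n≤o _ _ (numEdges-deleteInside Ĝ σ inside (lowerDegree-≤ Ĝ G σ Ĝ⊆G degree≤α))

  εn≤|S|α : ε' * fromℕ n ≤ℚ fromℕ (|S| ℕ.* α)
  εn≤|S|α = ≤-trans (far Ĝ′ (deleteInside-⊆ᴱ Ĝ inside) Ĝ′-HFree) (fromℕ-mono-≤ removed≤|S|α)
    where
    Ĝ′-HFree : HFree H Ĝ′
    Ĝ′-HFree = deleteInside-HFree H Ĝ inside (Connected⇒Edge H connected 2≤k) (inCopy-emb d)

  n-|S|+|S|≡n : n-|S| ℕ.+ |S| ≡ n
  n-|S|+|S|≡n = trans (countB-complement inside (allFin n)) (length-tabulate {n = n} id)
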